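{- Let $M=p_i^{n_i}p_j^{n_j}p_k^{n_k}$ with $p_i,p_j,p_k$ distinct primes and $n_i,n_j,n_k\in\mathbb{N}$. Assume $A\oplus B=\mathbb{Z}_M$, $\Phi_M(X)\mid A(X)$, and $A$ is fibered on $D(M)$-grids. Let $\Lambda=\Lambda(z_0,D(M))$ for some $z_0\in\mathbb{Z}_M$. (i) Suppose there exists $a\in\Sigma_A(\Lambda)\cap\mathcal{I}\cap\mathcal{J}\cap\mathcal{K}$ with $\kappa(a)=i$. Then $\kappa(a')=i$ for all $a'\in\Sigma_A(\Lambda)$; in particular $\Sigma_A(\Lambda)\subset\mathcal{I}$. (ii) Assume $\Sigma_A(\Lambda)\cap\mathcal{I}\cap\mathcal{J}\cap\mathcal{K}=\emptyset$. Then there is $S\subset\{i,j,k\}$ with $|S|\le2$ such that $\kappa(a)\in S$ for all $a\in\Sigma_A(\Lambda)$; in particular $\Sigma_A(\Lambda)$ is contained in the union of two of the sets $\mathcal{I},\mathcal{J},\mathcal{K}$. (iii) In the situation of (ii), assume (after permuting $i,j,k$) that $S=\{i,j\}$, and let $z_\nu=z_0+\nu M/p_k$ for $\nu=0,1,\dots,p_k-1$. Then for each $\nu$ there is $\lambda(\nu)\in\{i,j\}$ such that $\kappa(a)=\lambda(\nu)$ for all $a\in\Sigma_A(z_\nu*F_i*F_j)$.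
   Context: $A\oplus B=\mathbb{Z}_M$ means every element of $\mathbb{Z}_M$ is uniquely $a+b$, $a\in A,b\in B$. $A(X)=\sum_{a\in A}X^a$ (with $A\subset\{0,\dots,M-1\}$), $\Phi_M$ the $M$-th cyclotomic polynomial. $D(M)=M/(p_ip_jp_k)$. For $x\in\mathbb{Z}_M$ and $d\mid M$, $\Lambda(x,d)=\{x'\in\mathbb{Z}_M:d\mid x-x'\}$. For $\nu\in\{i,j,k\}$, $F_\nu=\{0,M/p_\nu,\dots,(p_\nu-1)M/p_\nu\}$, $x*F_\nu=\{x+f:f\in F_\nu\}$, and $x*F_i*F_j=\{x+f+g:f\in F_i,g\in F_j\}$. A set $Y$ is fibered in the $p_\nu$ direction if $Y=Y'*F_\nu$ for some $Y'\subset Y$ (disjoint fibers). $A$ is fibered on $D(M)$-grids if for every $a\in A$, $A\cap\Lambda(a,D(M))$ is fibered in some direction $p_\nu$. The direction function $\kappa:A\to\{i,j,k\}$: for each $D(M)$-grid $\Lambda(x,D(M))$ meeting $A$ choose (arbitrarily if several exist, then fixed) one $\nu(x)$ such that $A\cap\Lambda(x,D(M))$ is fibered in the $p_{\nu(x)}$ direction, and set $\kappa(a)=\nu(x)$ for $a\in A\cap\Lambda(x,D(M))$. $\mathcal{I}=\{a\in A:a*F_i\subset A\}$, and $\mathcal{J},\mathcal{K}$ analogously with $F_j,F_k$. For $Z\subset\mathbb{Z}_M$, $\Sigma_A(Z)=\{a\in A:a+b\in Z\text{ for some }b\in B\}$. -}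

module Defs where

open import Data.Bool using (Bool; true; false; if_then_else_; _∧_)
open import Data.Nat as ℕ using (ℕ; zero; suc; _∸_; _^_; _<_; _≤_)
open import Data.Nat.DivMod using (_mod_)
open import Data.Nat.Divisibility using (_∣?_)
open import Data.Integer as ℤ using (ℤ; +_; -_)
open import Data.Integer.Divisibility renaming (_∣_ to _∣ℤ_)
open import Data.Fin using (Fin; toℕ) renaming (zero to f0; suc to fs)
open import Data.Fin.Subset using (Subset; _∈_)
open import Data.List using (List; []; _∷_; map; length; reverse; drop; foldr; replicate; _++_; upTo; filterᵇ)
open import Data.Vec using (toList)
open import Data.Product using (Σ; _×_)
open import Relation.Binary.PropositionalEquality using (_≡_)
open import Relation.Nullary using (yes; no)
open import Relation.Nullary.Decidable using (⌊_⌋)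

-- Integer polynomials as coefficient lists (lowest degree first)

Poly : Set
Poly = List ℤ

coeff : Poly → ℕ → ℤ
coeff [] _ = + 0
coeff (c ∷ _) zero = c
coeff (_ ∷ cs) (suc m) = coeff cs m

-- equality of polynomials (ignores trailing zero coefficients)
_≈P_ : Poly → Poly → Set
P ≈P Q = ∀ m → coeff P m ≡ coeff Q m

_+P_ : Poly → Poly → Poly
[] +P Q = Q
(a ∷ P) +P [] = a ∷ P
(a ∷ P) +P (b ∷ Q) = (a ℤ.+ b) ∷ (P +P Q)

scaleP : ℤ → Poly → Poly
scaleP c = map (c ℤ.*_)

_*P_ : Poly → Poly → Poly
[] *P Q = []
(a ∷ P) *P Q = scaleP a Q +P (+ 0 ∷ (P *P Q))

_∣P_ : Poly → Poly → Set
D ∣P P = Σ Poly λ Q → (Q *P D) ≈P P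

-- long division by a monic polynomial (quotient only), on high-degree-first lists
subPrefix : List ℤ → List ℤ → List ℤ
subPrefix [] _ = []
subPrefix (r ∷ rs) [] = r ∷ rs
subPrefix (r ∷ rs) (d ∷ ds) = (r ℤ.- d) ∷ subPrefix rs ds

divHF : ℕ → List ℤ → List ℤ → List ℤ
divHF zero dt rem = []
divHF (suc f) dt [] = []
divHF (suc f) dt (r ∷ rs) with length dt ℕ.≤? length rs
... | yes _ = r ∷ divHF f dt (subPrefix rs (map (r ℤ.*_) dt))
... | no _ = []

divMonic : Poly → Poly → Poly
divMonic P D = reverse (divHF (length P) (drop 1 (reverse D)) (reverse P))

XmMinus1 : ℕ → Poly
XmMinus1 zero = []
XmMinus1 (suc m) = (- (+ 1)) ∷ (replicate m (+ 0) ++ (+ 1 ∷ []))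

prodP : List Poly → Poly
prodP = foldr _*P_ (+ 1 ∷ [])

properDivisors : ℕ → List ℕ
properDivisors m = filterᵇ (λ d → ⌊ 1 ℕ.≤? d ⌋ ∧ ⌊ d ∣? m ⌋) (upTo m)

-- Cyclotomic polynomials via  X^m - 1 = ∏_{d ∣ m} Φ_d ,
-- i.e. Φ_m = (X^m - 1) / ∏_{d ∣ m, d < m} Φ_d  (fuel = m suffices)
cycFuel : ℕ → ℕ → Poly
cycFuel zero m = []
cycFuel (suc f) m = divMonic (XmMinus1 m) (prodP (map (cycFuel f) (properDivisors m)))

Φ : ℕ → Poly
Φ m = cycFuel m m

-- mask polynomial A(X) = Σ_{a ∈ A} X^a
maskPoly : {m : ℕ} → Subset m → Poly
maskPoly A = map (λ b → if b then + 1 else + 0) (toList A)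

shift : {m : ℕ} → Fin m → ℕ → Fin m
shift {suc m} x t = (toℕ x ℕ.+ t) mod suc m

_⊕_ : {m : ℕ} → Fin m → Fin m → Fin m
x ⊕ y = shift x (toℕ y)

InGrid : {m : ℕ} → ℕ → Fin m → Fin m → Set
InGrid d x x' = (+ d) ∣ℤ ((+ toℕ x) ℤ.- (+ toℕ x'))

Dir : Set
Dir = Fin 3

iD jD kD : Dir
iD = f0
jD = fs f0
kD = fs (fs f0)

module Setup (p n : Dir → ℕ) where

  pw : Dir → ℕ
  pw ν = p ν ^ n ν

  pwm : Dir → ℕ
  pwm ν = p ν ^ (n ν ∸ 1)

  M : ℕ
  M = pw iD ℕ.* pw jD ℕ.* pw kD

  -- D(M) = M / (p_i p_j p_k)   (all n_ν ≥ 1)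
  DM : ℕ
  DM = pwm iD ℕ.* pwm jD ℕ.* pwm kD

  Mdiv : Dir → ℕ
  Mdiv f0 = pwm iD ℕ.* pw jD ℕ.* pw kD
  Mdiv (fs f0) = pw iD ℕ.* pwm jD ℕ.* pw kD
  Mdiv (fs (fs _)) = pw iD ℕ.* pw jD ℕ.* pwm kD

  ZM : Set
  ZM = Fin M

  InFiber : Dir → ZM → ZM → Set
  InFiber ν x y = Σ ℕ λ t → t < p ν × y ≡ shift x (t ℕ.* Mdiv ν)

  InIJ : ZM → ZM → Set
  InIJ x y = Σ ℕ λ s → Σ ℕ λ t → s < p iD × t < p jD ×
             y ≡ shift x (s ℕ.* Mdiv iD ℕ.+ t ℕ.* Mdiv jD)

  -- Y (a predicate on ℤ_M) is fibered in the p_ν direction: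
  -- Y = Y' * F_ν for some Y' ⊆ Y
  Fibered : (ZM → Set) → Dir → Set
  Fibered Y ν = Σ (Subset M) λ Y' → (∀ y → y ∈ Y' → Y y) ×
                (∀ z → (Y z → Σ ZM λ y → y ∈ Y' × InFiber ν y z) ×
                       (Σ ZM (λ y → y ∈ Y' × InFiber ν y z) → Y z))

  GridPart : Subset M → ZM → ZM → Set
  GridPart A a x = x ∈ A × InGrid DM a x

  Tiling : Subset M → Subset M → Set
  Tiling A B = (∀ x → Σ ZM λ a → Σ ZM λ b → a ∈ A × b ∈ B × (a ⊕ b) ≡ x) ×
               (∀ a b a' b' → a ∈ A → b ∈ B → a' ∈ A → b' ∈ B →
                  (a ⊕ b) ≡ (a' ⊕ b') → a ≡ a' × b ≡ b')

  FiberedOnGrids : Subset M → Set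
  FiberedOnGrids A = ∀ a → a ∈ A → Σ Dir λ ν → Fibered (GridPart A a) ν

  DirectionFunction : Subset M → (ZM → Dir) → Set
  DirectionFunction A κ =
    (∀ a → a ∈ A → Fibered (GridPart A a) (κ a)) ×
    (∀ a a' → a ∈ A → a' ∈ A → InGrid DM a a' → κ a ≡ κ a')

  -- 𝓘, 𝓙, 𝓚 :  a ∈ A with a * F_ν ⊆ A
  FullFiber : Subset M → Dir → ZM → Set
  FullFiber A ν a = a ∈ A × (∀ y → InFiber ν a y → y ∈ A)

  SigmaA : Subset M → Subset M → (ZM → Set) → ZM → Set
  SigmaA A B Z a = a ∈ A × Σ ZM λ b → b ∈ B × Z (a ⊕ b)

{-# OPTIONS --safe #-}

-- Read ℤ_M as the integers modulo M, so that a step along a p_ν-fiber adds a multiple of M/p_ν.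
-- The cofactors p_j p_k, p_i p_k, p_i p_j have no common factor, hence two points of one
-- D(M)-grid differ by α M/p_i + β M/p_j + γ M/p_k for some integers α, β, γ.
--
-- Everything rests on one collision argument. Let a₁ + b₁ and a₂ + b₂ (a's in A, b's in B) differ
-- by s M/p_ν + t M/p_μ, where ν = κ(a₁) and μ = κ(a₂). As the grids of a₁ and a₂ are fibered in
-- directions ν and μ, both a₁ + s M/p_ν and a₂ − t M/p_μ lie in A, and they give the same sum with
-- b₁ and b₂. By uniqueness in A ⊕ B they are equal, so a₁ and a₂ share a D(M)-grid and ν = μ.
-- (i) If κ(a) = i and a has full fibers, a′ of direction j (or k) collides with a moved first along
-- its k- (or j-) fiber. (ii) Given points of directions i, j and k, the element of A tiling the
-- corner x + α′ M/p_i + β″ M/p_j collides with one of them, whatever its own direction.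
-- (iii) Two points of z_ν * F_i * F_j differ by a combination of M/p_i and M/p_j.

module Submission where

open import Defs
open import Data.Nat using (ℕ; _<_; _≤_; _*_)
open import Data.Nat.Primality using (Prime)
open import Data.Fin using (Fin)
open import Data.Fin.Subset using (Subset; _∈_; ∣_∣)
open import Data.Product using (Σ; _×_)
open import Data.Sum using (_⊎_)
open import Relation.Binary.PropositionalEquality using (_≡_)
open import Relation.Nullary using (¬_)

open import Data.Empty using (⊥; ⊥-elim)
open import Data.Fin.Base using (zero; suc; toℕ; fromℕ<; punchIn; punchOut)
open import Data.Fin.Properties using (toℕ-fromℕ<; toℕ<n; toℕ-injective; punchIn-punchOut; any?; _≟_)
open import Data.Fin.Subset using (∁; ⁅_⁆)
open import Data.Fin.Subset.Properties using (_∈?_; x∉p⇒x∈∁p; x≢y⇒x∉⁅y⁆)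
open import Data.Integer.Base as ℤ using (ℤ; +_; 0ℤ; 1ℤ; -_; _+_; _-_; _%ℕ_; _/ℕ_) renaming (_*_ to _·_)
open import Data.Integer.Properties as ℤ using (pos-+; pos-*)
open import Data.Integer.DivMod using (a≡a%ℕn+[a/ℕn]*n; n%ℕd<d)
open import Data.Integer.Divisibility.Signed as Signed
  using (divides; ∣m∣n⇒∣m+n; ∣m⇒∣-m; ∣n⇒∣m*n; ∣ᵤ⇒∣; ∣⇒∣ᵤ)
open import Data.Integer.Tactic.RingSolver using (solve-∀)
import Data.Nat.Base as ℕ
import Data.Nat.Properties as ℕ
import Data.Nat.DivMod as ℕ
import Data.Nat.Divisibility as ℕ
import Data.Nat.Tactic.RingSolver as ℕ-Solver
open import Data.Nat.Primality using (prime⇒nonZero; prime⇒irreducible; euclidsLemma; ¬prime[1])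
open import Data.Nat.Coprimality using (Coprime; coprime-Bézout)
open import Data.Nat.GCD using (module Bézout)
open import Data.Product using (∃; ∃₂; _,_; proj₁; proj₂)
open import Data.Sum as Sum using (inj₁; inj₂)
open import Function.Base using (_∘_)
open import Relation.Binary.Bundles using (Setoid)
open import Relation.Binary.Structures using (IsEquivalence)
open import Relation.Binary.PropositionalEquality
  using (_≢_; refl; sym; trans; cong; cong₂; subst; module ≡-Reasoning)
import Relation.Binary.Reasoning.Setoid as SetoidReasoning
open import Relation.Nullary using (Dec; yes; no; contradiction)
open import Relation.Nullary.Decidable using (_×-dec_)

infix 4 _≡_mod_

record _≡_mod_ (x y : ℤ) (m : ℕ) : Set where
  constructor mk≡mod
  field divides-difference : + m Signed.∣ x - y

open _≡_mod_

module _ {m : ℕ} where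

  mod-reflexive : ∀ {x y} → x ≡ y → x ≡ y mod m
  mod-reflexive {x} refl = mk≡mod (divides 0ℤ (ℤ.+-inverseʳ x))

  mod-sym : ∀ {x y} → x ≡ y mod m → y ≡ x mod m
  mod-sym {x} {y} (mk≡mod m∣x-y) =
    mk≡mod (subst (+ m Signed.∣_) (negate x y) (∣m⇒∣-m m∣x-y))
    where negate : ∀ x y → - (x - y) ≡ y - x
          negate = solve-∀

  mod-trans : ∀ {x y z} → x ≡ y mod m → y ≡ z mod m → x ≡ z mod m
  mod-trans {x} {y} {z} (mk≡mod m∣x-y) (mk≡mod m∣y-z) =
    mk≡mod (subst (+ m Signed.∣_) (telescope x y z) (∣m∣n⇒∣m+n m∣x-y m∣y-z))
    where telescope : ∀ x y z → (x - y) + (y - z) ≡ x - z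
          telescope = solve-∀

  mod-isEquivalence : IsEquivalence (_≡_mod m)
  mod-isEquivalence = record { refl = mod-reflexive refl ; sym = mod-sym ; trans = mod-trans }

  mod-setoid : Setoid _ _
  mod-setoid = record { isEquivalence = mod-isEquivalence }

  +-cong-mod : ∀ {x y u v} → x ≡ y mod m → u ≡ v mod m → x + u ≡ y + v mod m
  +-cong-mod {x} {y} {u} {v} (mk≡mod m∣x-y) (mk≡mod m∣u-v) =
    mk≡mod (subst (+ m Signed.∣_) (regroup x y u v) (∣m∣n⇒∣m+n m∣x-y m∣u-v))
    where regroup : ∀ x y u v → (x - y) + (u - v) ≡ (x + u) - (y + v)
          regroup = solve-∀

  +-congˡ-mod : ∀ u {x y} → x ≡ y mod m → u + x ≡ u + y mod m
  +-congˡ-mod u = +-cong-mod (mod-reflexive {u} refl)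

  +-congʳ-mod : ∀ {x y} u → x ≡ y mod m → x + u ≡ y + u mod m
  +-congʳ-mod u x≡y = +-cong-mod x≡y (mod-reflexive refl)

  mod-weaken : ∀ {d x y} → d ℕ.∣ m → x ≡ y mod m → x ≡ y mod d
  mod-weaken d∣m (mk≡mod m∣x-y) = mk≡mod (Signed.∣-trans (∣ᵤ⇒∣ d∣m) m∣x-y)

  +-multiple-mod : ∀ x {z} → + m Signed.∣ z → x + z ≡ x mod m
  +-multiple-mod x {z} m∣z = mk≡mod (subst (+ m Signed.∣_) (cancel x z) m∣z)
    where cancel : ∀ x z → z ≡ (x + z) - x
          cancel = solve-∀

  z%ℕm≡z-mod : ∀ z .{{_ : ℕ.NonZero m}} → + (z %ℕ m) ≡ z mod m
  z%ℕm≡z-mod z = mod-sym (subst (_≡ + (z %ℕ m) mod m) (sym (a≡a%ℕn+[a/ℕn]*n z m))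
                              (+-multiple-mod (+ (z %ℕ m)) (divides (z /ℕ m) refl)))

module mod-Reasoning (m : ℕ) = SetoidReasoning (mod-setoid {m})

fromℤ : ∀ {m} .{{_ : ℕ.NonZero m}} → ℤ → Fin m
fromℤ {m} z = fromℕ< (n%ℕd<d z m)

⟦_⟧ : ∀ {m} → Fin m → ℤ
⟦ x ⟧ = + toℕ x

⟦shift⟧ : ∀ {m} (x : Fin m) t → ⟦ shift x t ⟧ ≡ ⟦ x ⟧ + + t mod m
⟦shift⟧ {ℕ.suc m} x t = begin
  ⟦ shift x t ⟧                 ≡⟨ cong +_ (toℕ-fromℕ< _) ⟩
  + ((toℕ x ℕ.+ t) ℕ.% ℕ.suc m) ≈⟨ z%ℕm≡z-mod (+ (toℕ x ℕ.+ t)) ⟩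
  + (toℕ x ℕ.+ t)               ≡⟨ pos-+ (toℕ x) t ⟩
  ⟦ x ⟧ + + t                   ∎
  where open mod-Reasoning (ℕ.suc m)

⟦⊕⟧ : ∀ {m} (x y : Fin m) → ⟦ x ⊕ y ⟧ ≡ ⟦ x ⟧ + ⟦ y ⟧ mod m
⟦⊕⟧ x y = ⟦shift⟧ x (toℕ y)

⊕-offset : ∀ {m} {a c : Fin m} b z → ⟦ c ⟧ ≡ ⟦ a ⟧ + z mod m → ⟦ c ⊕ b ⟧ ≡ ⟦ a ⊕ b ⟧ + z mod m
⊕-offset {m} {a} {c} b z c≡a+z = begin
  ⟦ c ⊕ b ⟧         ≈⟨ ⟦⊕⟧ c b ⟩
  ⟦ c ⟧ + ⟦ b ⟧     ≈⟨ +-congʳ-mod ⟦ b ⟧ c≡a+z ⟩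
  ⟦ a ⟧ + z + ⟦ b ⟧ ≡⟨ swap ⟦ a ⟧ z ⟦ b ⟧ ⟩
  ⟦ a ⟧ + ⟦ b ⟧ + z ≈⟨ +-congʳ-mod z (⟦⊕⟧ a b) ⟨
  ⟦ a ⊕ b ⟧ + z     ∎
  where
  swap : ∀ a z b → a + z + b ≡ a + b + z
  swap = solve-∀
  open mod-Reasoning m

⟦⟧-injective : ∀ {m} {x y : Fin m} → ⟦ x ⟧ ≡ ⟦ y ⟧ mod m → x ≡ y
⟦⟧-injective {m} {x} {y} (mk≡mod m∣x-y) with ℤ.∣ ⟦ x ⟧ - ⟦ y ⟧ ∣ in distance
... | ℕ.zero = toℕ-injective (ℤ.+-injective (begin
  ⟦ x ⟧                   ≡⟨ difference-plus ⟦ x ⟧ ⟦ y ⟧ ⟩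
  (⟦ x ⟧ - ⟦ y ⟧) + ⟦ y ⟧ ≡⟨ cong (_+ ⟦ y ⟧) (ℤ.∣i∣≡0⇒i≡0 {⟦ x ⟧ - ⟦ y ⟧} distance) ⟩
  0ℤ + ⟦ y ⟧              ≡⟨ ℤ.+-identityˡ ⟦ y ⟧ ⟩
  ⟦ y ⟧                   ∎))
  where open ≡-Reasoning
        difference-plus : ∀ x y → x ≡ (x - y) + y
        difference-plus = solve-∀
... | ℕ.suc k = contradiction (subst (m ℕ.∣_) distance (∣⇒∣ᵤ m∣x-y)) (ℕ.>⇒∤ (begin-strict
  ℕ.suc k               ≡⟨ distance ⟨
  ℤ.∣ ⟦ x ⟧ - ⟦ y ⟧ ∣   ≡⟨ cong ℤ.∣_∣ (ℤ.[+m]-[+n]≡m⊖n (toℕ x) (toℕ y)) ⟩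
  ℤ.∣ toℕ x ℤ.⊖ toℕ y ∣ ≤⟨ ℤ.∣m⊝n∣≤m⊔n (toℕ x) (toℕ y) ⟩
  toℕ x ℕ.⊔ toℕ y       <⟨ ℕ.⊔-pres-<m (toℕ<n x) (toℕ<n y) ⟩
  m                     ∎))
  where open ℕ.≤-Reasoning

⟦fromℤ⟧ : ∀ {m} .{{_ : ℕ.NonZero m}} z → ⟦ fromℤ {m} z ⟧ ≡ z mod m
⟦fromℤ⟧ {m} z = subst (_≡ z mod m) (cong +_ (sym (toℕ-fromℕ< _))) (z%ℕm≡z-mod z)

InGrid⇒mod : ∀ {m d} {x y : Fin m} → InGrid d x y → ⟦ x ⟧ ≡ ⟦ y ⟧ mod d
InGrid⇒mod d∣x-y = mk≡mod (∣ᵤ⇒∣ d∣x-y)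

mod⇒InGrid : ∀ {m d} {x y : Fin m} → ⟦ x ⟧ ≡ ⟦ y ⟧ mod d → InGrid d x y
mod⇒InGrid (mk≡mod d∣x-y) = ∣⇒∣ᵤ d∣x-y

distinct-primes⇒coprime : ∀ {p q} → Prime p → Prime q → p ≢ q → Coprime p q
distinct-primes⇒coprime prime-p prime-q p≢q (d∣p , d∣q) with prime⇒irreducible prime-p d∣p
... | inj₁ d≡1 = d≡1
... | inj₂ refl with prime⇒irreducible prime-q d∣q
...   | inj₁ p≡1 = contradiction (subst Prime p≡1 prime-p) ¬prime[1]
...   | inj₂ p≡q = contradiction p≡q p≢q

prime-coprime-* : ∀ {p m n} → Prime p → Coprime p m → Coprime p n → Coprime p (m * n)
prime-coprime-* {m = m} {n} prime-p p⊥m p⊥n (d∣p , d∣mn) with prime⇒irreducible prime-p d∣p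
... | inj₁ d≡1 = d≡1
... | inj₂ refl with euclidsLemma m n prime-p d∣mn
...   | inj₁ p∣m = p⊥m (d∣p , p∣m)
...   | inj₂ p∣n = p⊥n (d∣p , p∣n)

Bézout-+-⇒ℤ : ∀ {m n} x y → 1 ℕ.+ y * n ≡ x * m → + x · + m + - + y · + n ≡ 1ℤ
Bézout-+-⇒ℤ {m} {n} x y eq = begin
  + x · + m + - + y · + n       ≡⟨ cong (λ w → w + - + y · + n) (pos-* x m) ⟨
  + (x * m) + - + y · + n       ≡⟨ cong (λ w → + w + - + y · + n) eq ⟨
  + (1 ℕ.+ y * n) + - + y · + n ≡⟨ cong (λ w → w + - + y · + n) (pos-+ 1 (y * n)) ⟩
  1ℤ + + (y * n) + - + y · + n  ≡⟨ cong (λ w → 1ℤ + w + - + y · + n) (pos-* y n) ⟩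
  1ℤ + + y · + n + - + y · + n  ≡⟨ cancel (+ y) (+ n) ⟩
  1ℤ                            ∎
  where open ≡-Reasoning
        cancel : ∀ a b → 1ℤ + a · b + - a · b ≡ 1ℤ
        cancel = solve-∀

coprime⇒ℤ-Bézout : ∀ {m n} → Coprime m n → ∃₂ λ u v → u · + m + v · + n ≡ 1ℤ
coprime⇒ℤ-Bézout {m} {n} m⊥n with coprime-Bézout m⊥n
... | Bézout.+- x y eq = + x , - + y , Bézout-+-⇒ℤ x y eq
... | Bézout.-+ x y eq = - + x , + y , trans (ℤ.+-comm (- + x · + m) (+ y · + n)) (Bézout-+-⇒ℤ y x eq)

multiple⇒combination : ∀ {u v w a b c d z} → u · a + v · b + w · c ≡ 1ℤ → d Signed.∣ z →
  ∃ λ α → ∃₂ λ β γ → z ≡ α · (a · d) + β · (b · d) + γ · (c · d)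
multiple⇒combination {u} {v} {w} {a} {b} {c} {d} {z} bézout (divides q z≡q·d) =
  q · u , q · v , q · w , (begin
  z                                                   ≡⟨ z≡q·d ⟩
  q · d                                               ≡⟨ ℤ.*-identityʳ (q · d) ⟨
  q · d · 1ℤ                                          ≡⟨ cong (q · d ·_) bézout ⟨
  q · d · (u · a + v · b + w · c)                     ≡⟨ distribute q d u v w a b c ⟩
  q · u · (a · d) + q · v · (b · d) + q · w · (c · d) ∎)
  where
  distribute : ∀ q d u v w a b c →
    q · d · (u · a + v · b + w · c) ≡ q · u · (a · d) + q · v · (b · d) + q · w · (c · d)
  distribute = solve-∀
  open ≡-Reasoning

Dir-cases : ∀ {ℓ} {P : Set ℓ} (ν : Dir) → (ν ≡ iD → P) → (ν ≡ jD → P) → (ν ≡ kD → P) → P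
Dir-cases zero             i-case _      _      = i-case refl
Dir-cases (suc zero)       _      j-case _      = j-case refl
Dir-cases (suc (suc zero)) _      _      k-case = k-case refl

∣∁⁅x⁆∣≤2 : ∀ (δ : Fin 3) → ∣ ∁ ⁅ δ ⁆ ∣ ≤ 2
∣∁⁅x⁆∣≤2 zero = ℕ.≤-refl
∣∁⁅x⁆∣≤2 (suc zero) = ℕ.≤-refl
∣∁⁅x⁆∣≤2 (suc (suc zero)) = ℕ.≤-refl

≢⇒punchIn : ∀ {δ ν : Fin 3} → δ ≢ ν → ν ≡ punchIn δ zero ⊎ ν ≡ punchIn δ (suc zero)
≢⇒punchIn {δ} δ≢ν with punchOut δ≢ν | punchIn-punchOut δ≢ν
... | zero     | punchIn≡ν = inj₁ (sym punchIn≡ν)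
... | suc zero | punchIn≡ν = inj₂ (sym punchIn≡ν)

-- The modulus M, its fibers and its D(M)-grids

m^n≡m*m^[n∸1] : ∀ m n → 1 ≤ n → m ℕ.^ n ≡ m * m ℕ.^ (n ℕ.∸ 1)
m^n≡m*m^[n∸1] m (ℕ.suc n) _ = refl

module Grids (p n : Dir → ℕ) (prime : ∀ ν → Prime (p ν))
             (p-injective : ∀ ν μ → p ν ≡ p μ → ν ≡ μ) (n≥1 : ∀ ν → 1 ≤ n ν) where
  open Setup p n

  instance
    p≢0 : ∀ {ν} → ℕ.NonZero (p ν)
    p≢0 {ν} = prime⇒nonZero (prime ν)

    M≢0 : ℕ.NonZero M
    M≢0 = ℕ.m*n≢0 (pw iD * pw jD) (pw kD) {{ℕ.m*n≢0 (pw iD) (pw jD)}}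
      where instance
        pw≢0 : ∀ {ν} → ℕ.NonZero (pw ν)
        pw≢0 {ν} = ℕ.m^n≢0 (p ν) (n ν)

  pw≡p*pwm : ∀ ν → pw ν ≡ p ν * pwm ν
  pw≡p*pwm ν = m^n≡m*m^[n∸1] (p ν) (n ν) (n≥1 ν)

  cofactor : Dir → ℕ
  cofactor zero = p jD * p kD
  cofactor (suc zero) = p iD * p kD
  cofactor (suc (suc zero)) = p iD * p jD

  Mdiv≡cofactor*DM : ∀ ν → Mdiv ν ≡ cofactor ν * DM
  Mdiv≡cofactor*DM zero = begin
    pwm iD * pw jD * pw kD                     ≡⟨ cong₂ (λ b c → pwm iD * b * c) (pw≡p*pwm jD) (pw≡p*pwm kD) ⟩
    pwm iD * (p jD * pwm jD) * (p kD * pwm kD) ≡⟨ regroup (p jD) (p kD) (pwm iD) (pwm jD) (pwm kD) ⟩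
    p jD * p kD * DM                           ∎
    where regroup : ∀ b c x y z → x * (b * y) * (c * z) ≡ b * c * (x * y * z)
          regroup = ℕ-Solver.solve-∀
          open ≡-Reasoning
  Mdiv≡cofactor*DM (suc zero) = begin
    pw iD * pwm jD * pw kD                     ≡⟨ cong₂ (λ a c → a * pwm jD * c) (pw≡p*pwm iD) (pw≡p*pwm kD) ⟩
    (p iD * pwm iD) * pwm jD * (p kD * pwm kD) ≡⟨ regroup (p iD) (p kD) (pwm iD) (pwm jD) (pwm kD) ⟩
    p iD * p kD * DM                           ∎
    where regroup : ∀ a c x y z → a * x * y * (c * z) ≡ a * c * (x * y * z)
          regroup = ℕ-Solver.solve-∀
          open ≡-Reasoning
  Mdiv≡cofactor*DM (suc (suc zero)) = begin
    pw iD * pw jD * pwm kD                     ≡⟨ cong₂ (λ a b → a * b * pwm kD) (pw≡p*pwm iD) (pw≡p*pwm jD) ⟩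
    (p iD * pwm iD) * (p jD * pwm jD) * pwm kD ≡⟨ regroup (p iD) (p jD) (pwm iD) (pwm jD) (pwm kD) ⟩
    p iD * p jD * DM                           ∎
    where regroup : ∀ a b x y z → a * x * (b * y) * z ≡ a * b * (x * y * z)
          regroup = ℕ-Solver.solve-∀
          open ≡-Reasoning

  p*Mdiv≡M : ∀ ν → p ν * Mdiv ν ≡ M
  p*Mdiv≡M zero = begin
    p iD * (pwm iD * pw jD * pw kD) ≡⟨ regroup (p iD) (pwm iD) (pw jD) (pw kD) ⟩
    p iD * pwm iD * pw jD * pw kD   ≡⟨ cong (λ a → a * pw jD * pw kD) (pw≡p*pwm iD) ⟨
    M                               ∎
    where regroup : ∀ a x B C → a * (x * B * C) ≡ a * x * B * C
          regroup = ℕ-Solver.solve-∀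
          open ≡-Reasoning
  p*Mdiv≡M (suc zero) = begin
    p jD * (pw iD * pwm jD * pw kD) ≡⟨ regroup (p jD) (pw iD) (pwm jD) (pw kD) ⟩
    pw iD * (p jD * pwm jD) * pw kD ≡⟨ cong (λ b → pw iD * b * pw kD) (pw≡p*pwm jD) ⟨
    M                               ∎
    where regroup : ∀ b A y C → b * (A * y * C) ≡ A * (b * y) * C
          regroup = ℕ-Solver.solve-∀
          open ≡-Reasoning
  p*Mdiv≡M (suc (suc zero)) = begin
    p kD * (pw iD * pw jD * pwm kD) ≡⟨ regroup (p kD) (pw iD) (pw jD) (pwm kD) ⟩
    pw iD * pw jD * (p kD * pwm kD) ≡⟨ cong (λ c → pw iD * pw jD * c) (pw≡p*pwm kD) ⟨
    M                               ∎
    where regroup : ∀ c A B z → c * (A * B * z) ≡ A * B * (c * z)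
          regroup = ℕ-Solver.solve-∀
          open ≡-Reasoning

  M/p : Dir → ℤ
  M/p ν = + Mdiv ν

  DM∣Mdiv : ∀ ν → DM ℕ.∣ Mdiv ν
  DM∣Mdiv ν = subst (DM ℕ.∣_) (sym (Mdiv≡cofactor*DM ν)) (ℕ.n∣m*n (cofactor ν))

  DM∣M : DM ℕ.∣ M
  DM∣M = ℕ.∣-trans (DM∣Mdiv iD) (subst (Mdiv iD ℕ.∣_) (p*Mdiv≡M iD) (ℕ.n∣m*n (p iD)))

  M/p≡cofactor·DM : ∀ ν → M/p ν ≡ + cofactor ν · + DM
  M/p≡cofactor·DM ν = trans (cong +_ (Mdiv≡cofactor*DM ν)) (pos-* (cofactor ν) DM)

  p·M/p≡M : ∀ ν → + p ν · M/p ν ≡ + M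
  p·M/p≡M ν = trans (sym (pos-* (p ν) (Mdiv ν))) (cong +_ (p*Mdiv≡M ν))

  p-coprime : ∀ {ν μ} → ν ≢ μ → Coprime (p ν) (p μ)
  p-coprime {ν} {μ} ν≢μ = distinct-primes⇒coprime (prime ν) (prime μ) (ν≢μ ∘ p-injective ν μ)

  cofactor-Bézout : ∃ λ u → ∃₂ λ v w → u · + cofactor iD + v · + cofactor jD + w · + cofactor kD ≡ 1ℤ
  cofactor-Bézout
    with coprime⇒ℤ-Bézout (p-coprime {iD} {jD} λ ())
       | coprime⇒ℤ-Bézout (prime-coprime-* (prime kD) (p-coprime {kD} {iD} λ ()) (p-coprime {kD} {jD} λ ()))
  ... | r , s , r·pi+s·pj≡1 | a , b , a·pk+b·pipj≡1 = a · s , a · r , b , (begin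
    a · s · + (pj * pk) + a · r · + (pi * pk) + b · + (pi * pj)
      ≡⟨ cong₂ _+_ (cong₂ _+_ (cong (a · s ·_) (pos-* pj pk)) (cong (a · r ·_) (pos-* pi pk)))
                   (cong (b ·_) (pos-* pi pj)) ⟩
    a · s · (+ pj · + pk) + a · r · (+ pi · + pk) + b · (+ pi · + pj)
      ≡⟨ regroup a b r s (+ pi) (+ pj) (+ pk) ⟩
    a · + pk · (r · + pi + s · + pj) + b · (+ pi · + pj)
      ≡⟨ cong (λ x → a · + pk · x + b · (+ pi · + pj)) r·pi+s·pj≡1 ⟩
    a · + pk · 1ℤ + b · (+ pi · + pj)
      ≡⟨ cong₂ _+_ (ℤ.*-identityʳ (a · + pk)) (cong (b ·_) (sym (pos-* pi pj))) ⟩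
    a · + pk + b · + (pi * pj)
      ≡⟨ a·pk+b·pipj≡1 ⟩
    1ℤ ∎)
    where
    pi = p iD
    pj = p jD
    pk = p kD
    regroup : ∀ a b r s x y z →
      a · s · (y · z) + a · r · (x · z) + b · (x · y) ≡ a · z · (r · x + s · y) + b · (x · y)
    regroup = solve-∀
    open ≡-Reasoning

  DM∣⇒combination : ∀ {z} → + DM Signed.∣ z →
    ∃ λ α → ∃₂ λ β γ → z ≡ α · M/p iD + β · M/p jD + γ · M/p kD
  DM∣⇒combination {z} DM∣z =
    let u , v , w , bézout = cofactor-Bézout
        α , β , γ , z≡ = multiple⇒combination {u} {v} {w} {+ cofactor iD} {+ cofactor jD} {+ cofactor kD}
                                              bézout DM∣z
    in α , β , γ , (begin
      z
        ≡⟨ z≡ ⟩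
      α · (+ cofactor iD · + DM) + β · (+ cofactor jD · + DM) + γ · (+ cofactor kD · + DM)
        ≡⟨ cong₂ _+_ (cong₂ _+_ (cong (α ·_) (M/p≡cofactor·DM iD)) (cong (β ·_) (M/p≡cofactor·DM jD)))
                     (cong (γ ·_) (M/p≡cofactor·DM kD)) ⟨
      α · M/p iD + β · M/p jD + γ · M/p kD
        ∎)
    where open ≡-Reasoning

  record GridStep (x y : ℤ) : Set where
    constructor grid-step
    field
      α β γ : ℤ
      equation : y ≡ x + α · M/p iD + β · M/p jD + γ · M/p kD

  -- Opaque: letting the coefficients α, β, γ unfold makes the conversion checks below very slow.
  opaque
    same-grid⇒GridStep : ∀ {z x y : ZM} → InGrid DM z x → InGrid DM z y → GridStep ⟦ x ⟧ ⟦ y ⟧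
    same-grid⇒GridStep {z} {x} {y} z~x z~y =
      let y≡x = mod-trans (mod-sym (InGrid⇒mod {x = z} {y} z~y)) (InGrid⇒mod {x = z} {x} z~x)
          α , β , γ , y-x≡ = DM∣⇒combination (divides-difference y≡x)
      in grid-step α β γ (begin
        ⟦ y ⟧
          ≡⟨ add-difference ⟦ x ⟧ ⟦ y ⟧ ⟩
        ⟦ x ⟧ + (⟦ y ⟧ - ⟦ x ⟧)
          ≡⟨ cong (λ w → ⟦ x ⟧ + w) y-x≡ ⟩
        ⟦ x ⟧ + (α · M/p iD + β · M/p jD + γ · M/p kD)
          ≡⟨ reassociate ⟦ x ⟧ (α · M/p iD) (β · M/p jD) (γ · M/p kD) ⟩
        ⟦ x ⟧ + α · M/p iD + β · M/p jD + γ · M/p kD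
          ∎)
      where
      add-difference : ∀ x y → y ≡ x + (y - x)
      add-difference = solve-∀
      reassociate : ∀ x a b c → x + (a + b + c) ≡ x + a + b + c
      reassociate = solve-∀
      open ≡-Reasoning

  M/p-vanishes-mod-DM : ∀ x s ν → x + s · M/p ν ≡ x mod DM
  M/p-vanishes-mod-DM x s ν = +-multiple-mod x (∣n⇒∣m*n s (∣ᵤ⇒∣ (DM∣Mdiv ν)))

  fiber-coefficient-mod : ∀ s ν → s · M/p ν ≡ + (s %ℕ p ν) · M/p ν mod M
  fiber-coefficient-mod s ν = begin
    s · M/p ν                              ≡⟨ cong (_· M/p ν) (a≡a%ℕn+[a/ℕn]*n s (p ν)) ⟩
    (+ r + q · + p ν) · M/p ν              ≡⟨ distribute (+ r) q (+ p ν) (M/p ν) ⟩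
    + r · M/p ν + q · (+ p ν · M/p ν)      ≡⟨ cong (λ m → + r · M/p ν + q · m) (p·M/p≡M ν) ⟩
    + r · M/p ν + q · + M                  ≈⟨ +-multiple-mod (+ r · M/p ν) (divides q refl) ⟩
    + r · M/p ν                            ∎
    where
    r = s %ℕ p ν
    q = s /ℕ p ν
    distribute : ∀ r q p m → (r + q · p) · m ≡ r · m + q · (p · m)
    distribute = solve-∀
    open mod-Reasoning M

  ⟦shift-M/p⟧ : ∀ x t ν → ⟦ shift x (t * Mdiv ν) ⟧ ≡ ⟦ x ⟧ + + t · M/p ν mod M
  ⟦shift-M/p⟧ x t ν = begin
    ⟦ shift x (t * Mdiv ν) ⟧ ≈⟨ ⟦shift⟧ x (t * Mdiv ν) ⟩
    ⟦ x ⟧ + + (t * Mdiv ν)   ≡⟨ cong (λ w → ⟦ x ⟧ + w) (pos-* t (Mdiv ν)) ⟩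
    ⟦ x ⟧ + + t · M/p ν      ∎
    where open mod-Reasoning M

  InFiber⇒offset : ∀ {ν x y} → InFiber ν x y → ∃ λ s → ⟦ y ⟧ ≡ ⟦ x ⟧ + s · M/p ν mod M
  InFiber⇒offset {ν} {x} (t , _ , refl) = + t , ⟦shift-M/p⟧ x t ν

  offset⇒InFiber : ∀ {ν x y} s → ⟦ y ⟧ ≡ ⟦ x ⟧ + s · M/p ν mod M → InFiber ν x y
  offset⇒InFiber {ν} {x} {y} s y≡x+s·M/p = t , n%ℕd<d s (p ν) , ⟦⟧-injective (begin
    ⟦ y ⟧                    ≈⟨ y≡x+s·M/p ⟩
    ⟦ x ⟧ + s · M/p ν        ≈⟨ +-congˡ-mod ⟦ x ⟧ (fiber-coefficient-mod s ν) ⟩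
    ⟦ x ⟧ + + t · M/p ν      ≈⟨ ⟦shift-M/p⟧ x t ν ⟨
    ⟦ shift x (t * Mdiv ν) ⟧ ∎)
    where
    t = s %ℕ p ν
    open mod-Reasoning M

  InFiber-trans : ∀ {ν x y z} → InFiber ν x y → InFiber ν y z → InFiber ν x z
  InFiber-trans {ν} {x} {y} {z} x~y y~z with InFiber⇒offset x~y | InFiber⇒offset y~z
  ... | s , y≡ | t , z≡ = offset⇒InFiber (s + t) (begin
    ⟦ z ⟧                         ≈⟨ z≡ ⟩
    ⟦ y ⟧ + t · M/p ν             ≈⟨ +-congʳ-mod (t · M/p ν) y≡ ⟩
    ⟦ x ⟧ + s · M/p ν + t · M/p ν ≡⟨ collect ⟦ x ⟧ s t (M/p ν) ⟩
    ⟦ x ⟧ + (s + t) · M/p ν       ∎)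
    where
    collect : ∀ x s t m → x + s · m + t · m ≡ x + (s + t) · m
    collect = solve-∀
    open mod-Reasoning M

  InFiber⇒InGrid : ∀ {ν x y} → InFiber ν x y → InGrid DM x y
  InFiber⇒InGrid {ν} {x} {y} x~y with InFiber⇒offset x~y
  ... | s , y≡ = mod⇒InGrid (mod-sym (begin
    ⟦ y ⟧              ≈⟨ mod-weaken DM∣M y≡ ⟩
    ⟦ x ⟧ + s · M/p ν  ≈⟨ M/p-vanishes-mod-DM ⟦ x ⟧ s ν ⟩
    ⟦ x ⟧              ∎))
    where open mod-Reasoning DM

  InIJ⇒offset : ∀ {x y} → InIJ x y → ∃₂ λ s t → ⟦ y ⟧ ≡ ⟦ x ⟧ + s · M/p iD + t · M/p jD mod M
  InIJ⇒offset {x} (s , t , _ , _ , refl) = + s , + t , (begin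
    ⟦ shift x (s * Mdiv iD ℕ.+ t * Mdiv jD) ⟧
      ≈⟨ ⟦shift⟧ x (s * Mdiv iD ℕ.+ t * Mdiv jD) ⟩
    ⟦ x ⟧ + + (s * Mdiv iD ℕ.+ t * Mdiv jD)
      ≡⟨ cong (λ w → ⟦ x ⟧ + w) (pos-+ (s * Mdiv iD) (t * Mdiv jD)) ⟩
    ⟦ x ⟧ + (+ (s * Mdiv iD) + + (t * Mdiv jD))
      ≡⟨ cong₂ (λ u v → ⟦ x ⟧ + (u + v)) (pos-* s (Mdiv iD)) (pos-* t (Mdiv jD)) ⟩
    ⟦ x ⟧ + (+ s · M/p iD + + t · M/p jD)
      ≡⟨ ℤ.+-assoc ⟦ x ⟧ (+ s · M/p iD) (+ t · M/p jD) ⟨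
    ⟦ x ⟧ + + s · M/p iD + + t · M/p jD
      ∎)
    where open mod-Reasoning M

  InIJ-refl : ∀ x → InIJ x x
  InIJ-refl x = 0 , 0 , ℕ.>-nonZero⁻¹ (p iD) , ℕ.>-nonZero⁻¹ (p jD) , ⟦⟧-injective (begin
    ⟦ x ⟧         ≡⟨ ℤ.+-identityʳ ⟦ x ⟧ ⟨
    ⟦ x ⟧ + + 0   ≈⟨ ⟦shift⟧ x 0 ⟨
    ⟦ shift x 0 ⟧ ∎)
    where open mod-Reasoning M

  slice-in-grid : ∀ {z y} ν → InIJ (shift z (ν * Mdiv kD)) y → InGrid DM z y
  slice-in-grid {z} {y} ν centre~y =
    let s , t , y≡ = InIJ⇒offset centre~y
    in mod⇒InGrid {x = z} {y} (mod-sym (begin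
      ⟦ y ⟧
        ≈⟨ mod-weaken DM∣M y≡ ⟩
      ⟦ shift z (ν * Mdiv kD) ⟧ + s · M/p iD + t · M/p jD
        ≈⟨ +-congʳ-mod (t · M/p jD) (+-congʳ-mod (s · M/p iD) (mod-weaken DM∣M (⟦shift-M/p⟧ z ν kD))) ⟩
      z+νMk + s · M/p iD + t · M/p jD
        ≈⟨ +-congʳ-mod (t · M/p jD) (M/p-vanishes-mod-DM z+νMk s iD) ⟩
      z+νMk + t · M/p jD
        ≈⟨ M/p-vanishes-mod-DM z+νMk t jD ⟩
      z+νMk
        ≈⟨ M/p-vanishes-mod-DM ⟦ z ⟧ (+ ν) kD ⟩
      ⟦ z ⟧
        ∎))
    where
    z+νMk = ⟦ z ⟧ + + ν · M/p kD
    open mod-Reasoning DM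

  -- Directions of a fibered tiling

  module Directions {A B : Subset M} (tiling : Tiling A B)
                    {κ : ZM → Dir} (κ-direction : DirectionFunction A κ) where

    Σ-Λ : ZM → ZM → Set
    Σ-Λ z = SigmaA A B (InGrid DM z)

    κ-FullFiber : ∀ {a} → a ∈ A → FullFiber A (κ a) a
    κ-FullFiber {a} a∈A with proj₁ κ-direction a a∈A
    ... | Y′ , _ , cover with proj₁ (cover a) (a∈A , mod⇒InGrid {x = a} {a} (mod-reflexive refl))
    ...   | y₀ , y₀∈Y′ , y₀~a =
      a∈A , λ y a~y → proj₁ (proj₂ (cover y) (y₀ , y₀∈Y′ , InFiber-trans y₀~a a~y))

    κ≡⇒FullFiber : ∀ {a ν} → a ∈ A → κ a ≡ ν → FullFiber A ν a
    κ≡⇒FullFiber a∈A refl = κ-FullFiber a∈A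

    fiber-neighbour : ∀ {ρ a} → FullFiber A ρ a → ∀ s →
      ∃ λ c → c ∈ A × κ c ≡ κ a × (⟦ c ⟧ ≡ ⟦ a ⟧ + s · M/p ρ mod M)
    fiber-neighbour {ρ} {a} (a∈A , full) s =
      c , c∈A , sym (proj₂ κ-direction a c a∈A c∈A (InFiber⇒InGrid a~c)) , c≡
      where
      c : ZM
      c = fromℤ (⟦ a ⟧ + s · M/p ρ)
      c≡ : ⟦ c ⟧ ≡ ⟦ a ⟧ + s · M/p ρ mod M
      c≡ = ⟦fromℤ⟧ (⟦ a ⟧ + s · M/p ρ)
      a~c : InFiber ρ a c
      a~c = offset⇒InFiber s c≡
      c∈A : c ∈ A
      c∈A = full c a~c

    tiling-injective : ∀ {c₁ c₂ b₁ b₂} → c₁ ∈ A → c₂ ∈ A → b₁ ∈ B → b₂ ∈ B →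
      ⟦ c₁ ⊕ b₁ ⟧ ≡ ⟦ c₂ ⊕ b₂ ⟧ mod M → c₁ ≡ c₂
    tiling-injective {c₁} {c₂} {b₁} {b₂} c₁∈A c₂∈A b₁∈B b₂∈B sums≡ =
      proj₁ (proj₂ tiling c₁ b₁ c₂ b₂ c₁∈A b₁∈B c₂∈A b₂∈B (⟦⟧-injective sums≡))

    tile-point : ∀ z → ∃ λ a → ∃ λ b → a ∈ A × b ∈ B × (⟦ a ⊕ b ⟧ ≡ z mod M)
    tile-point z =
      let a , b , a∈A , b∈B , a⊕b≡z = proj₁ tiling (fromℤ z)
      in a , b , a∈A , b∈B , subst (_≡ z mod M) (cong ⟦_⟧ (sym a⊕b≡z)) (⟦fromℤ⟧ z)

    κ-plane : ∀ {a₁ a₂ b₁ b₂ ν μ} s t → a₁ ∈ A → a₂ ∈ A → b₁ ∈ B → b₂ ∈ B →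
      κ a₁ ≡ ν → κ a₂ ≡ μ → ⟦ a₂ ⊕ b₂ ⟧ ≡ ⟦ a₁ ⊕ b₁ ⟧ + s · M/p ν + t · M/p μ mod M → ν ≡ μ
    κ-plane {a₁} {a₂} {b₁} {b₂} s t a₁∈A a₂∈A b₁∈B b₂∈B refl refl x₂≡ =
      let c₁ , c₁∈A , κc₁≡κa₁ , c₁≡ = fiber-neighbour (κ-FullFiber a₁∈A) s
          c₂ , c₂∈A , κc₂≡κa₂ , c₂≡ = fiber-neighbour (κ-FullFiber a₂∈A) (- t)
          c₁≡c₂ = tiling-injective c₁∈A c₂∈A b₁∈B b₂∈B (begin
            ⟦ c₁ ⊕ b₁ ⟧                   ≈⟨ ⊕-offset b₁ u c₁≡ ⟩
            x₁ + u                        ≡⟨ cancel x₁ u t m₂ ⟩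
            x₁ + u + t · m₂ + - t · m₂    ≈⟨ +-congʳ-mod (- t · m₂) x₂≡ ⟨
            ⟦ a₂ ⊕ b₂ ⟧ + - t · m₂        ≈⟨ ⊕-offset b₂ (- t · m₂) c₂≡ ⟨
            ⟦ c₂ ⊕ b₂ ⟧                   ∎)
      in trans (sym κc₁≡κa₁) (trans (cong κ c₁≡c₂) κc₂≡κa₂)
      where
      x₁ = ⟦ a₁ ⊕ b₁ ⟧
      u = s · M/p (κ a₁)
      m₂ = M/p (κ a₂)
      cancel : ∀ x u t m → x + u ≡ x + u + t · m + - t · m
      cancel = solve-∀
      open mod-Reasoning M

    κ-plane-via-fiber : ∀ {ρ a₁ a₂ b₁ b₂ ν μ} r s t → FullFiber A ρ a₁ → a₂ ∈ A → b₁ ∈ B → b₂ ∈ B →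
      κ a₁ ≡ ν → κ a₂ ≡ μ →
      ⟦ a₂ ⊕ b₂ ⟧ ≡ ⟦ a₁ ⊕ b₁ ⟧ + r · M/p ρ + s · M/p ν + t · M/p μ mod M → ν ≡ μ
    κ-plane-via-fiber {ρ} {a₁} {a₂} {b₁} {b₂} {ν} {μ} r s t full a₂∈A b₁∈B b₂∈B κa₁≡ν κa₂≡μ x₂≡ =
      let c , c∈A , κc≡κa₁ , c≡ = fiber-neighbour full r
      in κ-plane s t c∈A a₂∈A b₁∈B b₂∈B (trans κc≡κa₁ κa₁≡ν) κa₂≡μ (begin
        ⟦ a₂ ⊕ b₂ ⟧
          ≈⟨ x₂≡ ⟩
        ⟦ a₁ ⊕ b₁ ⟧ + r · M/p ρ + s · M/p ν + t · M/p μ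
          ≈⟨ +-congʳ-mod (t · M/p μ) (+-congʳ-mod (s · M/p ν) (⊕-offset b₁ (r · M/p ρ) c≡)) ⟨
        ⟦ c ⊕ b₁ ⟧ + s · M/p ν + t · M/p μ
          ∎)
      where open mod-Reasoning M

    κ-plane-within : ∀ {a₁ a₂ b₁ b₂ ν μ} s t → a₁ ∈ A → a₂ ∈ A → b₁ ∈ B → b₂ ∈ B →
      κ a₁ ≡ ν ⊎ κ a₁ ≡ μ → κ a₂ ≡ ν ⊎ κ a₂ ≡ μ →
      ⟦ a₂ ⊕ b₂ ⟧ ≡ ⟦ a₁ ⊕ b₁ ⟧ + s · M/p ν + t · M/p μ mod M → κ a₁ ≡ κ a₂
    κ-plane-within _ _ _ _ _ _ (inj₁ κa₁≡ν) (inj₁ κa₂≡ν) _ = trans κa₁≡ν (sym κa₂≡ν)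
    κ-plane-within _ _ _ _ _ _ (inj₂ κa₁≡μ) (inj₂ κa₂≡μ) _ = trans κa₁≡μ (sym κa₂≡μ)
    κ-plane-within s t a₁∈A a₂∈A b₁∈B b₂∈B (inj₁ κa₁≡ν) (inj₂ κa₂≡μ) x₂≡ =
      trans κa₁≡ν (trans (κ-plane s t a₁∈A a₂∈A b₁∈B b₂∈B κa₁≡ν κa₂≡μ x₂≡) (sym κa₂≡μ))
    κ-plane-within {a₁} {a₂} {b₁} {b₂} {ν} {μ} s t a₁∈A a₂∈A b₁∈B b₂∈B (inj₂ κa₁≡μ) (inj₁ κa₂≡ν) x₂≡ =
      trans κa₁≡μ (trans (κ-plane t s a₁∈A a₂∈A b₁∈B b₂∈B κa₁≡μ κa₂≡ν x₂≡′) (sym κa₂≡ν))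
      where
      swap : ∀ x u v → x + u + v ≡ x + v + u
      swap = solve-∀
      x₂≡′ : ⟦ a₂ ⊕ b₂ ⟧ ≡ ⟦ a₁ ⊕ b₁ ⟧ + t · M/p μ + s · M/p ν mod M
      x₂≡′ = mod-trans x₂≡ (mod-reflexive (swap ⟦ a₁ ⊕ b₁ ⟧ (s · M/p ν) (t · M/p μ)))

    κ-forced-by-full-point : ∀ {z a a′} → Σ-Λ z a → FullFiber A jD a → FullFiber A kD a → κ a ≡ iD →
      Σ-Λ z a′ → κ a′ ≡ iD
    κ-forced-by-full-point {z} {a} {a′} (a∈A , b , b∈B , z~x) full-j full-k κa≡i (a′∈A , b′ , b′∈B , z~x′)
      with κ a′ in κa′≡
    ... | zero = refl
    ... | suc zero = contradiction
      (κ-plane-via-fiber {kD} {a} {a′} {b} {b′} {iD} {jD} γ α β full-k a′∈A b∈B b′∈B κa≡i κa′≡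
        (mod-reflexive (trans x′≡ (rotate ⟦ a ⊕ b ⟧ (α · M/p iD) (β · M/p jD) (γ · M/p kD)))))
      λ ()
      where
      open GridStep (same-grid⇒GridStep {z} {a ⊕ b} {a′ ⊕ b′} z~x z~x′) renaming (equation to x′≡)
      rotate : ∀ x a b c → x + a + b + c ≡ x + c + a + b
      rotate = solve-∀
    ... | suc (suc zero) = contradiction
      (κ-plane-via-fiber {jD} {a} {a′} {b} {b′} {iD} {kD} β α γ full-j a′∈A b∈B b′∈B κa≡i κa′≡
        (mod-reflexive (trans x′≡ (swap ⟦ a ⊕ b ⟧ (α · M/p iD) (β · M/p jD) (γ · M/p kD)))))
      λ ()
      where
      open GridStep (same-grid⇒GridStep {z} {a ⊕ b} {a′ ⊕ b′} z~x z~x′) renaming (equation to x′≡)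
      swap : ∀ x a b c → x + a + b + c ≡ x + b + a + c
      swap = solve-∀

    no-three-directions : ∀ {z a a′ a″} → Σ-Λ z a → Σ-Λ z a′ → Σ-Λ z a″ →
      κ a ≡ iD → κ a′ ≡ jD → κ a″ ≡ kD → ⊥
    no-three-directions {z} {a} {a′} {a″} (a∈A , b , b∈B , z~x) (a′∈A , b′ , b′∈B , z~x′)
                        (a″∈A , b″ , b″∈B , z~x″) κa≡i κa′≡j κa″≡k =
      let aq , bq , aq∈A , bq∈B , xq≡ = tile-point (⟦ a ⊕ b ⟧ + α′ · M/p iD + β″ · M/p jD)
      in Dir-cases (κ aq)
        (λ κaq≡i → contradiction
          (κ-plane (α″ - α′) γ″ aq∈A a″∈A bq∈B b″∈B κaq≡i κa″≡k (corner-to-x″ xq≡)) λ ())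
        (λ κaq≡j → contradiction
          (κ-plane α′ β″ a∈A aq∈A b∈B bq∈B κa≡i κaq≡j xq≡) λ ())
        (λ κaq≡k → contradiction
          (κ-plane γ′ (β′ - β″) aq∈A a′∈A bq∈B b′∈B κaq≡k κa′≡j (corner-to-x′ xq≡)) λ ())
      where
      open GridStep (same-grid⇒GridStep {z} {a ⊕ b} {a′ ⊕ b′} z~x z~x′)
        renaming (α to α′; β to β′; γ to γ′; equation to x′≡)
      open GridStep (same-grid⇒GridStep {z} {a ⊕ b} {a″ ⊕ b″} z~x z~x″)
        renaming (α to α″; β to β″; γ to γ″; equation to x″≡)
      open mod-Reasoning M
      to-x″ : ∀ x a′ a″ b c m n o →
        x + a″ · m + b · n + c · o ≡ x + a′ · m + b · n + (a″ - a′) · m + c · o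
      to-x″ = solve-∀
      to-x′ : ∀ x a b′ b c m n o →
        x + a · m + b′ · n + c · o ≡ x + a · m + b · n + c · o + (b′ - b) · n
      to-x′ = solve-∀
      corner-to-x″ : ∀ {xq} → xq ≡ ⟦ a ⊕ b ⟧ + α′ · M/p iD + β″ · M/p jD mod M →
        ⟦ a″ ⊕ b″ ⟧ ≡ xq + (α″ - α′) · M/p iD + γ″ · M/p kD mod M
      corner-to-x″ {xq} xq≡ = begin
        ⟦ a″ ⊕ b″ ⟧
          ≡⟨ trans x″≡ (to-x″ ⟦ a ⊕ b ⟧ α′ α″ β″ γ″ (M/p iD) (M/p jD) (M/p kD)) ⟩
        ⟦ a ⊕ b ⟧ + α′ · M/p iD + β″ · M/p jD + (α″ - α′) · M/p iD + γ″ · M/p kD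
          ≈⟨ +-congʳ-mod (γ″ · M/p kD) (+-congʳ-mod ((α″ - α′) · M/p iD) xq≡) ⟨
        xq + (α″ - α′) · M/p iD + γ″ · M/p kD
          ∎
      corner-to-x′ : ∀ {xq} → xq ≡ ⟦ a ⊕ b ⟧ + α′ · M/p iD + β″ · M/p jD mod M →
        ⟦ a′ ⊕ b′ ⟧ ≡ xq + γ′ · M/p kD + (β′ - β″) · M/p jD mod M
      corner-to-x′ {xq} xq≡ = begin
        ⟦ a′ ⊕ b′ ⟧
          ≡⟨ trans x′≡ (to-x′ ⟦ a ⊕ b ⟧ α′ β′ β″ γ′ (M/p iD) (M/p jD) (M/p kD)) ⟩
        ⟦ a ⊕ b ⟧ + α′ · M/p iD + β″ · M/p jD + γ′ · M/p kD + (β′ - β″) · M/p jD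
          ≈⟨ +-congʳ-mod ((β′ - β″) · M/p jD) (+-congʳ-mod (γ′ · M/p kD) xq≡) ⟨
        xq + γ′ · M/p kD + (β′ - β″) · M/p jD
          ∎

    κ-constant-on-slice : ∀ {z} → (∀ a → Σ-Λ z a → κ a ≡ iD ⊎ κ a ≡ jD) → ∀ ν →
      Σ Dir λ l → (l ≡ iD ⊎ l ≡ jD) × (∀ a → SigmaA A B (InIJ (shift z (ν * Mdiv kD))) a → κ a ≡ l)
    κ-constant-on-slice {z} two-directions ν =
      let a₀ , b₀ , a₀∈A , b₀∈B , a₀⊕b₀≡centre = proj₁ tiling centre
          a₀-in-slice = a₀∈A , b₀ , b₀∈B , subst (InIJ centre) (sym a₀⊕b₀≡centre) (InIJ-refl centre)
          κa₀∈ij = two-directions a₀ (slice⊆Λ a₀-in-slice)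
      in κ a₀ , κa₀∈ij , λ a a-in-slice@(a∈A , b , b∈B , centre~x) →
           let s , t , x≡ = InIJ⇒offset centre~x
           in sym (κ-plane-within s t a₀∈A a∈A b₀∈B b∈B κa₀∈ij (two-directions a (slice⊆Λ a-in-slice))
                     (subst (λ c → ⟦ a ⊕ b ⟧ ≡ ⟦ c ⟧ + s · M/p iD + t · M/p jD mod M) (sym a₀⊕b₀≡centre) x≡))
      where
      centre = shift z (ν * Mdiv kD)
      slice⊆Λ : ∀ {a} → SigmaA A B (InIJ centre) a → Σ-Λ z a
      slice⊆Λ (a∈A , b , b∈B , centre~x) = a∈A , b , b∈B , slice-in-grid ν centre~x

    direction-occurs? : ∀ z δ → Dec (∃ λ a → Σ-Λ z a × κ a ≡ δ)
    direction-occurs? z δ =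
      any? λ a → ((a ∈? A) ×-dec any? (λ b → (b ∈? B) ×-dec (DM ℕ.∣? _))) ×-dec (κ a ≟ δ)

    missing-direction : ∀ z → ∃ λ δ → ∀ a → Σ-Λ z a → κ a ≢ δ
    missing-direction z with direction-occurs? z iD | direction-occurs? z jD | direction-occurs? z kD
    ... | no ¬i | _ | _ = iD , λ a a∈Σ κa≡i → ¬i (a , a∈Σ , κa≡i)
    ... | yes _ | no ¬j | _ = jD , λ a a∈Σ κa≡j → ¬j (a , a∈Σ , κa≡j)
    ... | yes _ | yes _ | no ¬k = kD , λ a a∈Σ κa≡k → ¬k (a , a∈Σ , κa≡k)
    ... | yes (_ , a∈Σ , κa≡i) | yes (_ , a′∈Σ , κa′≡j) | yes (_ , a″∈Σ , κa″≡k) =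
      ⊥-elim (no-three-directions a∈Σ a′∈Σ a″∈Σ κa≡i κa′≡j κa″≡k)

    κ-in-two-directions : ∀ z →
      Σ (Subset 3) (λ S → ∣ S ∣ ≤ 2 × (∀ a → Σ-Λ z a → κ a ∈ S)) ×
      Σ Dir (λ ν₁ → Σ Dir λ ν₂ → ∀ a → Σ-Λ z a → FullFiber A ν₁ a ⊎ FullFiber A ν₂ a)
    κ-in-two-directions z =
      let δ , κ≢δ = missing-direction z
      in (∁ ⁅ δ ⁆ , ∣∁⁅x⁆∣≤2 δ , λ a a∈Σ → x∉p⇒x∈∁p (x≢y⇒x∉⁅y⁆ (κ≢δ a a∈Σ))) ,
         punchIn δ zero , punchIn δ (suc zero) ,
         λ a a∈Σ → Sum.map (κ≡⇒FullFiber (proj₁ a∈Σ)) (κ≡⇒FullFiber (proj₁ a∈Σ))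
                           (≢⇒punchIn (κ≢δ a a∈Σ ∘ sym))

lemma7p4 : (p n : Dir → ℕ) → (∀ ν → Prime (p ν)) → (∀ ν μ → p ν ≡ p μ → ν ≡ μ) →
    (∀ ν → 1 ≤ n ν) →
    let open Setup p n in
    (A B : Subset M) → Tiling A B → Φ M ∣P maskPoly A → FiberedOnGrids A →
    (κ : ZM → Dir) → DirectionFunction A κ → (z₀ : ZM) →
    let Σ-Λ = SigmaA A B (InGrid DM z₀) in
    -- (i)
    ((a : ZM) → Σ-Λ a → FullFiber A iD a → FullFiber A jD a → FullFiber A kD a →
       κ a ≡ iD →
       (∀ a' → Σ-Λ a' → κ a' ≡ iD) × (∀ a' → Σ-Λ a' → FullFiber A iD a'))
    ×
    -- (ii)
    ((∀ a → Σ-Λ a → ¬ (FullFiber A iD a × FullFiber A jD a × FullFiber A kD a)) →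
       Σ (Subset 3) (λ S → ∣ S ∣ ≤ 2 × (∀ a → Σ-Λ a → κ a ∈ S)) ×
       Σ Dir (λ ν₁ → Σ Dir λ ν₂ →
          ∀ a → Σ-Λ a → FullFiber A ν₁ a ⊎ FullFiber A ν₂ a))
    ×
    -- (iii)
    ((∀ a → Σ-Λ a → ¬ (FullFiber A iD a × FullFiber A jD a × FullFiber A kD a)) →
       (∀ a → Σ-Λ a → κ a ≡ iD ⊎ κ a ≡ jD) →
       (ν : ℕ) → ν < p kD →
       Σ Dir λ l → (l ≡ iD ⊎ l ≡ jD) ×
         (∀ a → SigmaA A B (InIJ (shift z₀ (ν * Mdiv kD))) a → κ a ≡ l))
-- Unused: Φ_M ∣ A(X) and FiberedOnGrids A (κ already carries the fibering), the i-fiber of a in (i),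
-- the emptiness hypothesis of (ii) and (iii) (the collision argument alone excludes three directions)
-- and the bound ν < p_k.
lemma7p4 p n prime p-injective n≥1 A B tiling _ _ κ κ-direction z₀ =
  (λ a a∈Σ _ full-j full-k κa≡i →
     let forced = λ a′ → κ-forced-by-full-point {a′ = a′} a∈Σ full-j full-k κa≡i
     in forced , λ a′ a′∈Σ → κ≡⇒FullFiber (proj₁ a′∈Σ) (forced a′ a′∈Σ)) ,
  (λ _ → κ-in-two-directions z₀) ,
  (λ _ two-directions ν _ → κ-constant-on-slice two-directions ν)
  where
  open Setup p n
  open Grids p n prime p-injective n≥1
  open Directions tiling κ-direction
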